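{- Let $\tau=\{V,H,C,U,P,Q\}$ ($V,H$ binary, $C,U,P,Q$ unary) and let $\mathfrak A$ be a $\tau$-structure. Then $\mathfrak A$ is striped and gridlike iff $\mathfrak A\not\models\varphi_{\mathit{non\text{ - }grid}}$, where $\varphi_{\mathit{non\text{ - }grid}}:=\varphi_{\mathit{non\text{ - }serial}}\vee\varphi_{|U|\neq2}\vee\varphi_{\mathit{non\text{ - }stripes}}\vee\varphi_{\mathit{non\text{ - }join}}$ and: $\varphi_{\mathit{non\text{ - }serial}}:=\exists x\forall y\neg V(x,y)\vee\exists x\forall y\neg H(x,y)$; $\varphi_{|U|\neq2}:=\varphi_{ns}(P)\vee\varphi_{ns}(Q)\vee\exists x(P(x)\wedge Q(x))\vee\exists x\big(U(x)\wedge\neg P(x)\wedge\neg Q(x)\big)\vee\exists x\big(\neg U(x)\wedge(P(x)\vee Q(x))\big)$ with $\varphi_{ns}(X):=\forall x\neg X(x)\vee\exists x\exists y(X(x)\wedge X(y)\wedge\neg x=y)$; $\varphi_{\mathit{non\text{ - }stripes}}:=\exists x\exists y\Big(\big(H(x,y)\wedge(C(x)\leftrightarrow\neg C(y))\big)\vee\big(V(x,y)\wedge(C(x)\leftrightarrow C(y))\big)\Big)$; $\varphi_{\mathit{non\text{ - }join}}:=\varphi_{\mathit{non\text{ - }C^+\text{ - }join}}\vee\varphi_{\mathit{non\text{ - }C^-\text{ - }join}}$, where $\varphi_{\mathit{non\text{ - }C^+\text{ - }join}}$ is $$\forall x\Big(\neg U(x)\vee\exists y\Big(C(y)\wedge{=}(y,x)\wedge\exists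 x\Big({=}(x,y)\wedge\big(({=}(x)\wedge H(x,y))\vee({=}(x)\wedge V(x,y))\big)\wedge\exists y\big({=}(y)\wedge(V(y,x)\vee H(y,x))\wedge\neg C(y)\big)\Big)\Big)\Big)$$ and $\varphi_{\mathit{non\text{ - }C^-\text{ - }join}}$ is obtained from it by replacing the first conjunct $C(y)$ by $\neg C(y)$ and the last conjunct $\neg C(y)$ by $C(y)$.
   Context: Team semantics (lax): an assignment is $s:D\to A$, $D$ a finite set of variables; a team is a set of assignments with common domain. A first-order formula (with $\leftrightarrow$ read as the usual first-order abbreviation) holds in a team iff every assignment in it satisfies it classically; $\wedge$ componentwise; $\psi\vee\vartheta$ holds in $X$ iff $X=Y\cup Z$ with $\psi$ holding in $Y$ and $\vartheta$ in $Z$; $\exists x\psi$ holds in $X$ iff $\psi$ holds in $\{s[a/x]:s\in X,a\in F(s)\}$ for some $F:X\to\mathcal P(A)\setminus\{\emptyset\}$; $\forall x\psi$ holds in $X$ iff $\psi$ holds in $\{s[a/x]:s\in X,a\in A\}$. Dependence atom ${=}(x_1,\dots,x_n,y)$ ($n\ge0$) holds in $X$ iff any two assignments agreeing on $x_1,\dots,x_n$ agree on $y$. A sentence is true in $\mathfrak A$ iff it holds in $\{\emptyset\}$. A structure $(A,V,H)$ is gridlike if $V$ and $H$ are serial (every element has a successor) and whenever $V(a,b)$, $H(b,c)$, $H(a,b')$, $V(b',c')$ then $c=c'$. A $\tau$-structure is striped and gridlike if its $\{V,H\}$-reduct is gridlike, the extensions of $P$ and $Q$ are distinct singletons, the extension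 of $U$ is the union of those of $P$ and $Q$, and for all $a,b$: $H(a,b)$ implies ($C(a)\Leftrightarrow C(b)$), and $V(a,b)$ implies ($C(a)\Leftrightarrow\neg C(b)$). -}

module Defs where

open import Level using (Level; 0ℓ) renaming (suc to lsuc)
open import Data.Nat using (ℕ; _≡ᵇ_)
open import Data.Bool using (if_then_else_)
open import Data.Maybe using (Maybe; just; nothing)
open import Data.List using (List; []; _∷_)
open import Data.List.Relation.Unary.All using (All)
open import Data.Product using (Σ; Σ-syntax; _×_; _,_)
open import Data.Sum using (_⊎_)
open import Data.Empty using (⊥)
open import Relation.Nullary using (¬_)
open import Relation.Binary.PropositionalEquality using (_≡_; _≢_)

record Structure : Set₁ where
  field
    Carrier : Set
    V H     : Carrier → Carrier → Set
    C U P Q : Carrier → Set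

data Rel2 : Set where
  `V `H : Rel2

data Rel1 : Set where
  `C `U `P `Q : Rel1

Var : Set
Var = ℕ

infixr 6 _∧ᶠ_ _∧ᵈ_
infixr 5 _∨ᶠ_ _∨ᵈ_
infix 4 _↔ᶠ_

data FO : Set where
  rel2  : Rel2 → Var → Var → FO
  rel1  : Rel1 → Var → FO
  _≐_   : Var → Var → FO
  ¬ᶠ_   : FO → FO
  _∧ᶠ_  : FO → FO → FO
  _∨ᶠ_  : FO → FO → FO
  _↔ᶠ_  : FO → FO → FO
  ∃ᶠ    : Var → FO → FO
  ∀ᶠ    : Var → FO → FO

data DL : Set where
  fo    : FO → DL
  dep   : List Var → Var → DL     -- =(x₁,…,xₙ,y)
  _∧ᵈ_  : DL → DL → DL
  _∨ᵈ_  : DL → DL → DL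
  ∃ᵈ    : Var → DL → DL
  ∀ᵈ    : Var → DL → DL

module Semantics (𝔄 : Structure) where
  open Structure 𝔄 renaming (Carrier to A)

  -- an assignment with finite domain: undefined variables map to nothing
  Assignment : Set
  Assignment = Var → Maybe A

  _[_/_] : Assignment → A → Var → Assignment
  (s [ a / x ]) v = if v ≡ᵇ x then just a else s v

  _≗ₐ_ : Assignment → Assignment → Set
  s ≗ₐ t = ∀ v → s v ≡ t v

  ⟦_⟧₂ : Rel2 → A → A → Set
  ⟦ `V ⟧₂ = V
  ⟦ `H ⟧₂ = H

  ⟦_⟧₁ : Rel1 → A → Set
  ⟦ `C ⟧₁ = C
  ⟦ `U ⟧₁ = U
  ⟦ `P ⟧₁ = P
  ⟦ `Q ⟧₁ = Q

  _⊨ᶠ_ : Assignment → FO → Set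
  s ⊨ᶠ rel2 r x y = Σ[ a ∈ A ] Σ[ b ∈ A ] (s x ≡ just a × s y ≡ just b × ⟦ r ⟧₂ a b)
  s ⊨ᶠ rel1 r x   = Σ[ a ∈ A ] (s x ≡ just a × ⟦ r ⟧₁ a)
  s ⊨ᶠ (x ≐ y)    = Σ[ a ∈ A ] (s x ≡ just a × s y ≡ just a)
  s ⊨ᶠ (¬ᶠ φ)     = ¬ (s ⊨ᶠ φ)
  s ⊨ᶠ (φ ∧ᶠ ψ)   = s ⊨ᶠ φ × s ⊨ᶠ ψ
  s ⊨ᶠ (φ ∨ᶠ ψ)   = s ⊨ᶠ φ ⊎ s ⊨ᶠ ψ
  s ⊨ᶠ (φ ↔ᶠ ψ)   = (s ⊨ᶠ φ → s ⊨ᶠ ψ) × (s ⊨ᶠ ψ → s ⊨ᶠ φ)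
  s ⊨ᶠ ∃ᶠ x φ     = Σ[ a ∈ A ] ((s [ a / x ]) ⊨ᶠ φ)
  s ⊨ᶠ ∀ᶠ x φ     = ∀ (a : A) → (s [ a / x ]) ⊨ᶠ φ

  Team : Set₁
  Team = Assignment → Set

  -- X[F/x] = { s[a/x] : s ∈ X, a ∈ F(s) }   (up to pointwise equality)
  supplement : (X : Team) → ((s : Assignment) → X s → A → Set) → Var → Team
  supplement X F x t = Σ[ s ∈ Assignment ] Σ[ p ∈ X s ] Σ[ a ∈ A ] (F s p a × t ≗ₐ (s [ a / x ]))

  duplicate : Team → Var → Team
  duplicate X x t = Σ[ s ∈ Assignment ] (X s × Σ[ a ∈ A ] (t ≗ₐ (s [ a / x ])))

  -- lax team semantics
  _⊨ᵀ_ : Team → DL → Set₁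
  X ⊨ᵀ fo φ      = Level.Lift (lsuc 0ℓ) (∀ s → X s → s ⊨ᶠ φ)
  X ⊨ᵀ dep xs y  = Level.Lift (lsuc 0ℓ)
                     (∀ s t → X s → X t → All (λ v → s v ≡ t v) xs → s y ≡ t y)
  X ⊨ᵀ (φ ∧ᵈ ψ)  = X ⊨ᵀ φ × X ⊨ᵀ ψ
  X ⊨ᵀ (φ ∨ᵈ ψ)  = Σ[ Y ∈ Team ] Σ[ Z ∈ Team ]
                     ((∀ s → (X s → Y s ⊎ Z s) × (Y s ⊎ Z s → X s)) × Y ⊨ᵀ φ × Z ⊨ᵀ ψ)
  X ⊨ᵀ ∃ᵈ x φ    = Σ[ F ∈ ((s : Assignment) → X s → A → Set) ]
                     ((∀ s (p : X s) → Σ[ a ∈ A ] F s p a) × supplement X F x ⊨ᵀ φ)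
  X ⊨ᵀ ∀ᵈ x φ    = duplicate X x ⊨ᵀ φ

  emptyTeam : Team
  emptyTeam s = ∀ v → s v ≡ nothing

_⊨_ : Structure → DL → Set₁
𝔄 ⊨ φ = let open Semantics 𝔄 in emptyTeam ⊨ᵀ φ

module _ (𝔄 : Structure) where
  open Structure 𝔄 renaming (Carrier to A)

  Gridlike : Set
  Gridlike = (∀ a → Σ[ b ∈ A ] V a b)
           × (∀ a → Σ[ b ∈ A ] H a b)
           × (∀ a b c b' c' → V a b → H b c → H a b' → V b' c' → c ≡ c')

  IsSingleton : (A → Set) → A → Set
  IsSingleton X p = X p × (∀ x → X x → x ≡ p)

  StripedGridlike : Set
  StripedGridlike = Gridlike
    × (Σ[ p ∈ A ] Σ[ q ∈ A ] (IsSingleton P p × IsSingleton Q q × p ≢ q))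
    × (∀ a → (U a → P a ⊎ Q a) × (P a ⊎ Q a → U a))
    × (∀ a b → H a b → (C a → C b) × (C b → C a))
    × (∀ a b → V a b → (C a → ¬ C b) × (¬ C b → C a))

x y : Var
x = 0
y = 1

V' H' : Var → Var → FO
V' = rel2 `V
H' = rel2 `H

C' U' P' Q' : Var → FO
C' = rel1 `C
U' = rel1 `U
P' = rel1 `P
Q' = rel1 `Q

φ-non-serial : FO
φ-non-serial = ∃ᶠ x (∀ᶠ y (¬ᶠ V' x y)) ∨ᶠ ∃ᶠ x (∀ᶠ y (¬ᶠ H' x y))

φ-ns : Rel1 → FO
φ-ns X = ∀ᶠ x (¬ᶠ rel1 X x)
      ∨ᶠ ∃ᶠ x (∃ᶠ y (rel1 X x ∧ᶠ rel1 X y ∧ᶠ ¬ᶠ (x ≐ y)))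

φ-U≠2 : FO
φ-U≠2 = φ-ns `P ∨ᶠ φ-ns `Q
      ∨ᶠ ∃ᶠ x (P' x ∧ᶠ Q' x)
      ∨ᶠ ∃ᶠ x (U' x ∧ᶠ ¬ᶠ P' x ∧ᶠ ¬ᶠ Q' x)
      ∨ᶠ ∃ᶠ x (¬ᶠ U' x ∧ᶠ (P' x ∨ᶠ Q' x))

φ-non-stripes : FO
φ-non-stripes = ∃ᶠ x (∃ᶠ y ((H' x y ∧ᶠ (C' x ↔ᶠ ¬ᶠ C' y))
                         ∨ᶠ (V' x y ∧ᶠ (C' x ↔ᶠ C' y))))

φ-join-shape : FO → FO → DL
φ-join-shape first last =
  ∀ᵈ x (fo (¬ᶠ U' x) ∨ᵈ
    ∃ᵈ y (fo first ∧ᵈ dep (y ∷ []) x ∧ᵈ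
      ∃ᵈ x (dep (x ∷ []) y
            ∧ᵈ ((dep [] x ∧ᵈ fo (H' x y)) ∨ᵈ (dep [] x ∧ᵈ fo (V' x y)))
            ∧ᵈ ∃ᵈ y (dep [] y ∧ᵈ fo (V' y x ∨ᶠ H' y x) ∧ᵈ fo last))))

φ-non-C⁺-join : DL
φ-non-C⁺-join = φ-join-shape (C' y) (¬ᶠ C' y)

φ-non-C⁻-join : DL
φ-non-C⁻-join = φ-join-shape (¬ᶠ C' y) (C' y)

φ-non-join : DL
φ-non-join = φ-non-C⁺-join ∨ᵈ φ-non-C⁻-join

φ-non-grid : DL
φ-non-grid = fo (φ-non-serial ∨ᶠ φ-U≠2 ∨ᶠ φ-non-stripes) ∨ᵈ φ-non-join

module Submission where

-- The first-order disjunct φ-first-order is, classically, the negation of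
-- the first-order conditions of the definition (seriality, P and Q distinct
-- singletons with U = P ∪ Q, stripes); we prove this condition by condition
-- ('first-order⇔').  The only clause left is the grid equation, and it is
-- captured by the two join formulas through the notion of a *join witness*:
-- a point d with V- or H-edges to points cH ≠ cV, from which an H-edge and a
-- V-edge lead to distinct points bH ≠ bV of the same colour, d having the
-- opposite colour.  Tracing the assignments x ↦ p and x ↦ q (U = {p, q})
-- through the join formula shows that it holds in a nonempty team only if a
-- join witness exists ('join-sound'); conversely a join witness lets us
-- choose values making it true in any team ('join-complete').  Under the
-- stripe conditions a join witness is exactly a failure of the grid equation
-- ('witness-breaks-grid', 'failure-witness').  Excluded middle is needed only to recover the conditions from the
-- failure of φ-non-grid; the soundness lemmas are constructive.

open import Defs
open import Level using (0ℓ; lift; lower) renaming (suc to lsuc)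
open import Axiom.ExcludedMiddle using (ExcludedMiddle)
open import Relation.Nullary using (¬_; Dec; yes; no)
open import Relation.Nullary.Decidable using (map′; decidable-stable; toSum)
open import Relation.Nullary.Negation using (contradiction)
open import Function using (id; _∘_)
open import Function.Bundles using (_⇔_; mk⇔; Equivalence)
open import Function.Properties.Equivalence using () renaming (trans to ⇔-trans)
open import Data.Nat using (_≡ᵇ_)
open import Data.Bool using (true; false)
open import Data.Bool.Properties using (T-≡)
open import Data.Nat.Properties using (≡ᵇ⇒≡; ≡⇒≡ᵇ)
open import Data.Maybe using (Maybe; just; nothing)
open import Data.Maybe.Properties using (just-injective)
open import Data.List using ([]; _∷_)
open import Data.List.Relation.Unary.All using (All; []; _∷_)
open import Data.Product using (Σ; Σ-syntax; _×_; _,_; proj₁; proj₂)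
open import Data.Sum as Sum using (_⊎_; inj₁; inj₂; [_,_]′)
open import Data.Empty using (⊥; ⊥-elim)
open import Relation.Binary.PropositionalEquality
  using (_≡_; _≢_; refl; sym; trans; cong; subst)

×-¬⊎ : {P Q R S : Set} → P ⇔ (¬ R) → Q ⇔ (¬ S) → (P × Q) ⇔ (¬ (R ⊎ S))
×-¬⊎ P⇔ Q⇔ = mk⇔
  (λ (p , q) → [ Equivalence.to P⇔ p , Equivalence.to Q⇔ q ]′)
  (λ ¬R⊎S → Equivalence.from P⇔ (¬R⊎S ∘ inj₁) , Equivalence.from Q⇔ (¬R⊎S ∘ inj₂))

∀-¬Σ : {I : Set} {P R : I → Set} → (∀ i → P i ⇔ (¬ R i)) → (∀ i → P i) ⇔ (¬ Σ I R)
∀-¬Σ P⇔ = mk⇔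
  (λ all (i , r) → Equivalence.to (P⇔ i) (all i) r)
  (λ ¬ex i → Equivalence.from (P⇔ i) (λ r → ¬ex (i , r)))

-- The first-order disjunct of φ-non-grid, and the layers of the join formula:
-- φ-join-shape f l = ∀x (¬U(x) ∨ branches f l), definitionally.
φ-first-order : FO
φ-first-order = φ-non-serial ∨ᶠ φ-U≠2 ∨ᶠ φ-non-stripes

corner-body : FO → DL
corner-body l = dep [] y ∧ᵈ fo (V' y x ∨ᶠ H' y x) ∧ᵈ fo l

corner : FO → DL
corner l = ∃ᵈ y (corner-body l)

sides-body : FO → DL
sides-body l = dep (x ∷ []) y
             ∧ᵈ ((dep [] x ∧ᵈ fo (H' x y)) ∨ᵈ (dep [] x ∧ᵈ fo (V' x y)))
             ∧ᵈ corner l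

sides : FO → DL
sides l = ∃ᵈ x (sides-body l)

branches-body : FO → FO → DL
branches-body f l = fo f ∧ᵈ dep (y ∷ []) x ∧ᵈ sides l

branches : FO → FO → DL
branches f l = ∃ᵈ y (branches-body f l)

module _ (𝔄 : Structure) where
  open Structure 𝔄 renaming (Carrier to A)
  open Semantics 𝔄

  update-self : ∀ (s : Assignment) a w → (s [ a / w ]) w ≡ just a
  update-self s a w rewrite Equivalence.to T-≡ (≡⇒≡ᵇ w w refl) = refl

  update-other : ∀ (s : Assignment) a {v w} → v ≢ w → (s [ a / w ]) v ≡ s v
  update-other s a {v} {w} v≢w with v ≡ᵇ w in v≡ᵇw
  ... | false = refl
  ... | true  = contradiction (≡ᵇ⇒≡ v w (Equivalence.from T-≡ v≡ᵇw)) v≢w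

  -- Reading an atomic formula whose variables have known values; stated for
  -- the unfolded satisfaction clause, so that the values can be inferred.
  atom₁ : ∀ r {m : Maybe A} {a} → m ≡ just a → Σ[ c ∈ A ] (m ≡ just c × ⟦ r ⟧₁ c) → ⟦ r ⟧₁ a
  atom₁ r m≡a (_ , m≡c , holds) = subst ⟦ r ⟧₁ (just-injective (trans (sym m≡c) m≡a)) holds

  Edge : Rel2 → Maybe A → Maybe A → Set
  Edge r m n = Σ[ c ∈ A ] Σ[ d ∈ A ] (m ≡ just c × n ≡ just d × ⟦ r ⟧₂ c d)

  atom₂ : ∀ r {m n : Maybe A} {a b} → m ≡ just a → n ≡ just b → Edge r m n → ⟦ r ⟧₂ a b
  atom₂ r m≡a n≡b (_ , _ , m≡c , n≡d , holds)
    with just-injective (trans (sym m≡c) m≡a) | just-injective (trans (sym n≡d) n≡b)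
  ... | refl | refl = holds

  -- The empty team satisfies every formula; it fills the unused half of a split.
  empty-satisfies : (X : Team) → (∀ s → ¬ X s) → (φ : DL) → X ⊨ᵀ φ
  empty-satisfies X empty (fo φ)    = lift λ s m → ⊥-elim (empty s m)
  empty-satisfies X empty (dep _ _) = lift λ s _ m _ _ → ⊥-elim (empty s m)
  empty-satisfies X empty (φ ∧ᵈ ψ)  = empty-satisfies X empty φ , empty-satisfies X empty ψ
  empty-satisfies X empty (φ ∨ᵈ ψ)  =
    X , X , (λ s → inj₁ , [ id , id ]′) , empty-satisfies X empty φ , empty-satisfies X empty ψ
  empty-satisfies X empty (∃ᵈ _ φ)  =
    (λ _ _ _ → ⊥) , (λ s m → ⊥-elim (empty s m)) ,
    empty-satisfies _ (λ { _ (s , m , _) → empty s m }) φ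
  empty-satisfies X empty (∀ᵈ _ φ)  = empty-satisfies _ (λ { _ (s , m , _) → empty s m }) φ

  -- A disjunction holds if one disjunct does (the other side gets the empty team).
  ∨-introˡ : ∀ {X : Team} φ ψ → X ⊨ᵀ φ → X ⊨ᵀ (φ ∨ᵈ ψ)
  ∨-introˡ {X} φ ψ holds =
    X , (λ _ → ⊥) , (λ s → inj₁ , [ id , ⊥-elim ]′) , holds , empty-satisfies _ (λ _ ()) ψ

  ∨-introʳ : ∀ {X : Team} φ ψ → X ⊨ᵀ ψ → X ⊨ᵀ (φ ∨ᵈ ψ)
  ∨-introʳ {X} φ ψ holds =
    (λ _ → ⊥) , X , (λ s → inj₂ , [ ⊥-elim , id ]′) , empty-satisfies _ (λ _ ()) φ , holds

  _∈⊨_ : Assignment → DL → Set₁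
  s ∈⊨ φ = Σ[ X ∈ Team ] (X s × X ⊨ᵀ φ)

  ∨-elim : ∀ {s φ ψ} → s ∈⊨ (φ ∨ᵈ ψ) → s ∈⊨ φ ⊎ s ∈⊨ ψ
  ∨-elim (X , m , Y , Z , cover , holdsY , holdsZ) =
    Sum.map (λ inY → Y , inY , holdsY) (λ inZ → Z , inZ , holdsZ) (proj₁ (cover _) m)

  choose : ∀ {X : Team} {F : (s : Assignment) → X s → A → Set} v →
           (∀ s (m : X s) → Σ[ a ∈ A ] F s m a) →
           ∀ {s} (m : X s) → Σ[ a ∈ A ] supplement X F v (s [ a / v ])
  choose v total {s} m =
    proj₁ (total s m) , s , m , proj₁ (total s m) , proj₂ (total s m) , λ _ → refl

  dep-contrapositive : ∀ {X : Team} {v w s t} → X ⊨ᵀ dep (v ∷ []) w →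
                       X s → X t → s w ≢ t w → s v ≢ t v
  dep-contrapositive (lift agree) m n w≢ v≡ = w≢ (agree _ _ m n (v≡ ∷ []))

  distinct-values : ∀ {m n : Maybe A} {a b} → m ≡ just a → n ≡ just b → a ≢ b → m ≢ n
  distinct-values m≡a n≡b a≢b m≡n = a≢b (just-injective (trans (sym m≡a) (trans m≡n n≡b)))

  separate-sides : ∀ {S : Team} {v φ ψ u₁ u₂} →
    S ⊨ᵀ ((dep [] v ∧ᵈ fo φ) ∨ᵈ (dep [] v ∧ᵈ fo ψ)) → S u₁ → S u₂ → u₁ v ≢ u₂ v →
    (u₁ ⊨ᶠ φ × u₂ ⊨ᶠ ψ) ⊎ (u₂ ⊨ᶠ φ × u₁ ⊨ᶠ ψ)
  separate-sides (_ , _ , cover , (lift constY , lift φ-holds) , (lift constZ , lift ψ-holds))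
                 m₁ m₂ v≢
    with proj₁ (cover _) m₁ | proj₁ (cover _) m₂
  ... | inj₁ y₁ | inj₁ y₂ = ⊥-elim (v≢ (constY _ _ y₁ y₂ []))
  ... | inj₂ z₁ | inj₂ z₂ = ⊥-elim (v≢ (constZ _ _ z₁ z₂ []))
  ... | inj₁ y₁ | inj₂ z₂ = inj₁ (φ-holds _ y₁ , ψ-holds _ z₂)
  ... | inj₂ z₁ | inj₁ y₂ = inj₂ (φ-holds _ y₂ , ψ-holds _ z₁)

  TwoValues : Team → Var → A → A → Set
  TwoValues X v a₁ a₂ = ∀ t → X t → t v ≡ just a₁ ⊎ t v ≡ just a₂

  TwoPairs : Team → Var → Var → A → A → A → A → Set
  TwoPairs X v w a₁ b₁ a₂ b₂ =
    ∀ t → X t → (t v ≡ just a₁ × t w ≡ just b₁) ⊎ (t v ≡ just a₂ × t w ≡ just b₂)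

  constant-dep : ∀ {X : Team} {v a} → (∀ t → X t → t v ≡ just a) → X ⊨ᵀ dep [] v
  constant-dep const = lift λ s t m n _ → trans (const s m) (sym (const t n))

  pairs-dep : ∀ {X : Team} {v w a₁ b₁ a₂ b₂} → TwoPairs X v w a₁ b₁ a₂ b₂ → b₁ ≢ b₂ →
              X ⊨ᵀ dep (w ∷ []) v
  pairs-dep {X} {v} {w} pairs b₁≢b₂ = lift agree
    where
    agree : ∀ s t → X s → X t → All (λ u → s u ≡ t u) (w ∷ []) → s v ≡ t v
    agree s t m n (w≡ ∷ []) with pairs s m | pairs t n
    ... | inj₁ (sv , _)  | inj₁ (tv , _)  = trans sv (sym tv)
    ... | inj₂ (sv , _)  | inj₂ (tv , _)  = trans sv (sym tv)
    ... | inj₁ (_ , sw)  | inj₂ (_ , tw)  = contradiction w≡ (distinct-values sw tw b₁≢b₂)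
    ... | inj₂ (_ , sw)  | inj₁ (_ , tw)  = contradiction (sym w≡) (distinct-values tw sw b₁≢b₂)

  ∃-follow : ∀ {X : Team} {v w a₁ a₂ b₁ b₂ φ} → v ≢ w → TwoValues X v a₁ a₂ →
             (∀ {Y : Team} → TwoPairs Y v w a₁ b₁ a₂ b₂ → Y ⊨ᵀ φ) → X ⊨ᵀ ∃ᵈ w φ
  ∃-follow {X} {v} {w} {a₁} {a₂} {b₁} {b₂} v≢w values body = follow , total , body pairs
    where
    follow : (s : Assignment) → X s → A → Set
    follow s _ b = (s v ≡ just a₁ × b ≡ b₁) ⊎ (s v ≡ just a₂ × b ≡ b₂)
    total : ∀ s (m : X s) → Σ[ b ∈ A ] follow s m b
    total s m = [ (λ sv → b₁ , inj₁ (sv , refl)) , (λ sv → b₂ , inj₂ (sv , refl)) ]′ (values s m)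
    located : ∀ {t s b a} → t ≗ₐ (s [ b / w ]) → s v ≡ just a → t v ≡ just a × t w ≡ just b
    located {t} {s} {b} t≗ sv =
      trans (t≗ v) (trans (update-other s b v≢w) sv) , trans (t≗ w) (update-self s b w)
    pairs : TwoPairs (supplement X follow w) v w a₁ b₁ a₂ b₂
    pairs t (_ , _ , _ , inj₁ (sv , refl) , t≗) = inj₁ (located t≗ sv)
    pairs t (_ , _ , _ , inj₂ (sv , refl) , t≗) = inj₂ (located t≗ sv)

  ∨-cover : ∀ {X : Team} φ ψ (Π₁ Π₂ : Assignment → Set) → (∀ t → X t → Π₁ t ⊎ Π₂ t) →
            (λ t → X t × Π₁ t) ⊨ᵀ φ → (λ t → X t × Π₂ t) ⊨ᵀ ψ → X ⊨ᵀ (φ ∨ᵈ ψ)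
  ∨-cover _ _ Π₁ Π₂ cover holds₁ holds₂ =
    _ , _ , (λ t → (λ m → Sum.map (m ,_) (m ,_) (cover t m)) , [ proj₁ , proj₁ ]′) , holds₁ , holds₂

  edge-side : ∀ r {Y : Team} {v w a b} → (∀ t → Y t → t v ≡ just a × t w ≡ just b) →
              ⟦ r ⟧₂ a b → Y ⊨ᵀ (dep [] v ∧ᵈ fo (rel2 r v w))
  edge-side r at edge =
    constant-dep (λ t → proj₁ ∘ at t) , lift λ t m → _ , _ , proj₁ (at t m) , proj₂ (at t m) , edge

  Serial : Set
  Serial = (∀ a → Σ[ b ∈ A ] V a b) × (∀ a → Σ[ b ∈ A ] H a b)

  TwoPoints : Set
  TwoPoints = Σ[ p ∈ A ] Σ[ q ∈ A ] (IsSingleton 𝔄 P p × IsSingleton 𝔄 Q q × p ≢ q)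

  UnionPQ : Set
  UnionPQ = ∀ a → (U a → P a ⊎ Q a) × (P a ⊎ Q a → U a)

  StripedBy : (A → Set) → Set
  StripedBy K = (∀ a b → H a b → (K a → K b) × (K b → K a))
              × (∀ a b → V a b → (K a → ¬ K b) × (¬ K b → K a))

  U-two-points : TwoPoints × UnionPQ →
    Σ[ p ∈ A ] Σ[ q ∈ A ] (U p × U q × p ≢ q × (∀ u → U u → u ≡ p ⊎ u ≡ q))
  U-two-points ((p , q , (Pp , onlyP) , (Qq , onlyQ) , p≢q) , union) =
    p , q , proj₂ (union p) (inj₁ Pp) , proj₂ (union q) (inj₂ Qq) , p≢q ,
    λ u Uu → Sum.map (onlyP u) (onlyQ u) (proj₁ (union u) Uu)

  FirstOrderConditions : Set
  FirstOrderConditions = Serial × (TwoPoints × UnionPQ) × StripedBy C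

  GridEquation : Set
  GridEquation = ∀ a b c b′ c′ → V a b → H b c → H a b′ → V b′ c′ → c ≡ c′

  -- Stripes by K are also stripes by ¬K (this lets one argument serve both join formulas).
  striped-¬ : ∀ {K} → StripedBy K → StripedBy (¬_ ∘ K)
  striped-¬ (hs , vs) =
    (λ a b h → (λ ¬Ka Kb → ¬Ka (proj₂ (hs a b h) Kb)) , (λ ¬Kb Ka → ¬Kb (proj₁ (hs a b h) Ka))) ,
    (λ a b v → (λ ¬Ka ¬Kb → ¬Ka (proj₂ (vs a b v) ¬Kb)) , (λ ¬¬Kb Ka → ¬¬Kb (proj₁ (vs a b v) Ka)))

  VH : A → A → Set
  VH a b = V a b ⊎ H a b

  record JoinWitness (Fst Lst : A → Set) : Set where
    constructor join-witness
    field
      d cH bH cV bV : A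
      H-edge : H cH bH
      V-edge : V cV bV
      d-cH   : VH d cH
      d-cV   : VH d cV
      bH≢bV  : bH ≢ bV
      cH≢cV  : cH ≢ cV
      Fst-bH : Fst bH
      Fst-bV : Fst bV
      Lst-d  : Lst d

  record Expresses (f : FO) (K : A → Set) : Set where
    field
      sound    : ∀ {s b} → s y ≡ just b → s ⊨ᶠ f → K b
      complete : ∀ {s b} → s y ≡ just b → K b → s ⊨ᶠ f

  expresses-C : Expresses (C' y) C
  expresses-C = record { sound = atom₁ `C ; complete = λ sy Cb → _ , sy , Cb }

  expresses-¬C : Expresses (¬ᶠ C' y) (¬_ ∘ C)
  expresses-¬C = record
    { sound    = λ sy ¬Cy Cb → ¬Cy (_ , sy , Cb)
    ; complete = λ sy ¬Cb Cy → ¬Cb (atom₁ `C sy Cy) }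

  -- Soundness of the join formula, layer by layer from the inside: two members
  -- are traced through the quantifiers, and the dependence atoms keep them apart.
  read-VH : ∀ {m n : Maybe A} {d c} → m ≡ just d → n ≡ just c → Edge `V m n ⊎ Edge `H m n → VH d c
  read-VH m≡d n≡c = Sum.map (atom₂ `V m≡d n≡c) (atom₂ `H m≡d n≡c)

  corner-sound : ∀ {T : Team} {l Lst} → Expresses l Lst → T ⊨ᵀ corner l →
    ∀ {u₁ u₂ c₁ c₂} → T u₁ → T u₂ → u₁ x ≡ just c₁ → u₂ x ≡ just c₂ →
    Σ[ d ∈ A ] (Lst d × VH d c₁ × VH d c₂)
  corner-sound el (_ , total , lift same-d , lift edge , lift last) m₁ m₂ ux₁ ux₂
    with choose y total m₁ | choose y total m₂
  ... | d₁ , w₁ | d₂ , w₂ =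
    d₁ , Expresses.sound el refl (last _ w₁) , read-VH refl ux₁ (edge _ w₁) ,
    subst (λ d → VH d _) (just-injective (same-d _ _ w₂ w₁ [])) (read-VH refl ux₂ (edge _ w₂))

  sides-sound : ∀ {S : Team} {l Fst Lst} → Expresses l Lst → S ⊨ᵀ sides l →
    ∀ {t₁ t₂ b₁ b₂} → S t₁ → S t₂ → t₁ y ≡ just b₁ → t₂ y ≡ just b₂ → b₁ ≢ b₂ →
    Fst b₁ → Fst b₂ → JoinWitness Fst Lst
  sides-sound el (_ , total , x→y , split , corner-holds) {b₁ = b₁} {b₂ = b₂}
              m₁ m₂ ty₁ ty₂ b₁≢b₂ f₁ f₂
    with choose x total m₁ | choose x total m₂
  ... | c₁ , n₁ | c₂ , n₂
    with dep-contrapositive x→y n₁ n₂ (distinct-values ty₁ ty₂ b₁≢b₂)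
  ... | x-differ
    with separate-sides {φ = H' x y} {ψ = V' x y} split n₁ n₂ x-differ
       | corner-sound el corner-holds n₁ n₂ refl refl
  ... | inj₁ (h₁ , v₂) | d , ld , vh₁ , vh₂ =
    join-witness d c₁ b₁ c₂ b₂ (atom₂ `H refl ty₁ h₁) (atom₂ `V refl ty₂ v₂) vh₁ vh₂
                 b₁≢b₂ (x-differ ∘ cong just) f₁ f₂ ld
  ... | inj₂ (h₂ , v₁) | d , ld , vh₁ , vh₂ =
    join-witness d c₂ b₂ c₁ b₁ (atom₂ `H refl ty₂ h₂) (atom₂ `V refl ty₁ v₁) vh₂ vh₁
                 (b₁≢b₂ ∘ sym) (x-differ ∘ cong just ∘ sym) f₂ f₁ ld

  branches-sound : ∀ {B : Team} {f l Fst Lst} → Expresses f Fst → Expresses l Lst →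
    B ⊨ᵀ branches f l → ∀ {s₁ s₂} → B s₁ → B s₂ → s₁ x ≢ s₂ x → JoinWitness Fst Lst
  branches-sound ef el (_ , total , lift first , y→x , sides-holds) m₁ m₂ x≢
    with choose y total m₁ | choose y total m₂
  ... | b₁ , t₁ | b₂ , t₂ =
    sides-sound el sides-holds t₁ t₂ refl refl (dep-contrapositive y→x t₁ t₂ x≢ ∘ cong just)
                (Expresses.sound ef refl (first _ t₁)) (Expresses.sound ef refl (first _ t₂))

  join-sound : ∀ {s f l Fst Lst p q} → Expresses f Fst → Expresses l Lst →
    s ∈⊨ φ-join-shape f l → U p → U q → p ≢ q → JoinWitness Fst Lst
  join-sound {s} ef el (W , m , _ , Z , cover , lift outside-U , branches-holds) Up Uq p≢q =
    branches-sound ef el branches-holds (in-Z Up) (in-Z Uq) (p≢q ∘ just-injective)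
    where
    in-Z : ∀ {u} → U u → Z (s [ u / x ])
    in-Z {u} Uu = [ (λ inY → ⊥-elim (outside-U _ inY (u , refl , Uu))) , id ]′
                    (proj₁ (cover _) (s , m , u , λ _ → refl))

  -- Completeness of the join formula, layer by layer from the inside: each
  -- quantifier is witnessed by following the two branches of the join witness.
  VH-holds : ∀ {m n : Maybe A} {d c} → m ≡ just d → n ≡ just c → VH d c → Edge `V m n ⊎ Edge `H m n
  VH-holds m≡d n≡c = Sum.map (λ v → _ , _ , m≡d , n≡c , v) (λ h → _ , _ , m≡d , n≡c , h)

  corner-complete : ∀ {X : Team} {l Lst d c₁ c₂} → Expresses l Lst → Lst d → VH d c₁ → VH d c₂ →
    TwoValues X x c₁ c₂ → X ⊨ᵀ corner l
  corner-complete {l = l} {d = d} el ld vh₁ vh₂ xs =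
    ∃-follow {w = y} {b₁ = d} {b₂ = d} {φ = corner-body l} (λ ()) xs λ pairs →
    constant-dep (λ t m → [ proj₂ , proj₂ ]′ (pairs t m)) ,
    lift (λ t m → [ (λ (tx , ty) → VH-holds ty tx vh₁) , (λ (tx , ty) → VH-holds ty tx vh₂) ]′ (pairs t m)) ,
    lift (λ t m → Expresses.complete el ([ proj₂ , proj₂ ]′ (pairs t m)) ld)

  sides-complete : ∀ {X : Team} {l Fst Lst} → Expresses l Lst → (w : JoinWitness Fst Lst) →
    TwoValues X y (JoinWitness.bH w) (JoinWitness.bV w) → X ⊨ᵀ sides l
  sides-complete {l = l} el (join-witness d cH bH cV bV hH vV dH dV _ cH≢cV _ _ ld) ys =
    ∃-follow {w = x} {b₁ = cH} {b₂ = cV} {φ = sides-body l} (λ ()) ys λ pairs →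
      pairs-dep pairs cH≢cV ,
      ∨-cover (dep [] x ∧ᵈ fo (H' x y)) (dep [] x ∧ᵈ fo (V' x y)) _ _ pairs
        (edge-side `H (λ t (_ , ty , tx) → tx , ty) hH)
        (edge-side `V (λ t (_ , ty , tx) → tx , ty) vV) ,
      corner-complete el ld dH dV (λ t m → Sum.map proj₂ proj₂ (pairs t m))

  branches-complete : ∀ {X : Team} {f l Fst Lst p q} → Expresses f Fst → Expresses l Lst →
    JoinWitness Fst Lst → TwoValues X x p q → X ⊨ᵀ branches f l
  branches-complete {f = f} {l = l} ef el w xs =
    ∃-follow {w = y} {b₁ = bH} {b₂ = bV} {φ = branches-body f l} (λ ()) xs λ pairs →
    lift (λ t m → [ (λ (_ , ty) → Expresses.complete ef ty Fst-bH)
                  , (λ (_ , ty) → Expresses.complete ef ty Fst-bV) ]′ (pairs t m)) ,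
    pairs-dep pairs bH≢bV ,
    sides-complete el w (λ t m → Sum.map proj₂ proj₂ (pairs t m))
    where open JoinWitness w

  -- Under stripes by K, a join witness with Lst ⊆ ¬K breaks the grid equation:
  -- the colours force V(d,cH) and H(d,cV), and the grid equation would give bH = bV.
  witness-breaks-grid : ∀ {K Lst} → GridEquation → StripedBy K → (∀ {e} → Lst e → ¬ K e) →
                        ¬ JoinWitness K Lst
  witness-breaks-grid {K} grid (hs , vs) Lst⇒¬K
    (join-witness d cH bH cV bV hH vV dH dV bH≢bV _ KbH KbV Ld) =
    bH≢bV (grid d cH bH cV bV V-d-cH hH H-d-cV vV)
    where
    KcH : K cH
    KcH = proj₂ (hs cH bH hH) KbH
    ¬KcV : ¬ K cV
    ¬KcV KcV = proj₁ (vs cV bV vV) KcV KbV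
    V-d-cH : V d cH
    V-d-cH = [ id , (λ h → ⊥-elim (Lst⇒¬K Ld (proj₂ (hs d cH h) KcH))) ]′ dH
    H-d-cV : H d cV
    H-d-cV = [ (λ v → ⊥-elim (Lst⇒¬K Ld (proj₂ (vs d cV v) ¬KcV))) , id ]′ dV

  -- Under the grid equation and C-stripes, with U = {p, q}, neither join formula
  -- holds in a nonempty team: the C⁻-join is the C⁺-join for the colour ¬C.
  join-refuted : ∀ {s} → GridEquation → TwoPoints × UnionPQ → StripedBy C → ¬ (s ∈⊨ φ-non-join)
  join-refuted grid shape stripes holds
    with U-two-points shape | ∨-elim {φ = φ-non-C⁺-join} {ψ = φ-non-C⁻-join} holds
  ... | _ , _ , Up , Uq , p≢q , _ | inj₁ C⁺ =
    witness-breaks-grid grid stripes id (join-sound expresses-C expresses-¬C C⁺ Up Uq p≢q)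
  ... | _ , _ , Up , Uq , p≢q , _ | inj₂ C⁻ =
    witness-breaks-grid grid (striped-¬ stripes) (λ Ce ¬Ce → ¬Ce Ce)
      (join-sound expresses-¬C expresses-C C⁻ Up Uq p≢q)

  module Classical (em : ExcludedMiddle (lsuc 0ℓ)) where

    decide : (X : Set) → Dec X
    decide X = map′ lower lift em

    stable : {X : Set} → ¬ ¬ X → X
    stable {X} = decidable-stable (decide X)

    successors⇔ : ∀ s r → (∀ a → Σ[ b ∈ A ] ⟦ r ⟧₂ a b) ⇔ (¬ (s ⊨ᶠ ∃ᶠ x (∀ᶠ y (¬ᶠ rel2 r x y))))
    successors⇔ s r = mk⇔
      (λ serial (a , none) → none (proj₁ (serial a)) (a , _ , refl , refl , proj₂ (serial a)))
      (λ ¬φ a → stable λ none → ¬φ (a , λ b edge → none (b , atom₂ r refl refl edge)))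

    serial⇔ : ∀ s → Serial ⇔ (¬ (s ⊨ᶠ φ-non-serial))
    serial⇔ s = ×-¬⊎ (successors⇔ s `V) (successors⇔ s `H)

    singleton⇔ : ∀ s r → (Σ[ p ∈ A ] IsSingleton 𝔄 ⟦ r ⟧₁ p) ⇔ (¬ (s ⊨ᶠ φ-ns r))
    singleton⇔ s r = mk⇔ refute establish
      where
      refute : (Σ[ p ∈ A ] IsSingleton 𝔄 ⟦ r ⟧₁ p) → ¬ (s ⊨ᶠ φ-ns r)
      refute (p , Rp , _)    (inj₁ none) = none p (p , refl , Rp)
      refute (p , _ , unique) (inj₂ (a , b , Ra , Rb , a≢b)) =
        a≢b (p , cong just (unique a (atom₁ r refl Ra)) , cong just (unique b (atom₁ r refl Rb)))
      establish : ¬ (s ⊨ᶠ φ-ns r) → Σ[ p ∈ A ] IsSingleton 𝔄 ⟦ r ⟧₁ p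
      establish ¬φ = proj₁ inhabited , proj₂ inhabited , unique
        where
        inhabited : Σ[ p ∈ A ] ⟦ r ⟧₁ p
        inhabited = stable λ empty → ¬φ (inj₁ λ a Ra → empty (a , atom₁ r refl Ra))
        unique : ∀ z → ⟦ r ⟧₁ z → z ≡ proj₁ inhabited
        unique z Rz = stable λ z≢p → ¬φ (inj₂ (z , proj₁ inhabited , (z , refl , Rz) ,
          (proj₁ inhabited , refl , proj₂ inhabited) ,
          λ (_ , e₁ , e₂) → z≢p (just-injective (trans e₁ (sym e₂)))))

    disjoint⇔ : ∀ s → (∀ a → P a → ¬ Q a) ⇔ (¬ (s ⊨ᶠ ∃ᶠ x (P' x ∧ᶠ Q' x)))
    disjoint⇔ s = mk⇔
      (λ disjoint (a , Pa , Qa) → disjoint a (atom₁ `P refl Pa) (atom₁ `Q refl Qa))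
      (λ ¬φ a Pa Qa → ¬φ (a , (a , refl , Pa) , (a , refl , Qa)))

    U⊆P∪Q⇔ : ∀ s → (∀ a → U a → P a ⊎ Q a) ⇔ (¬ (s ⊨ᶠ ∃ᶠ x (U' x ∧ᶠ ¬ᶠ P' x ∧ᶠ ¬ᶠ Q' x)))
    U⊆P∪Q⇔ s = mk⇔
      (λ sub (a , Ua , ¬Pa , ¬Qa) →
        [ (λ Pa → ¬Pa (a , refl , Pa)) , (λ Qa → ¬Qa (a , refl , Qa)) ]′ (sub a (atom₁ `U refl Ua)))
      (λ ¬φ a Ua → stable λ ¬P⊎Q → ¬φ (a , (a , refl , Ua) ,
        (λ Pa → ¬P⊎Q (inj₁ (atom₁ `P refl Pa))) , (λ Qa → ¬P⊎Q (inj₂ (atom₁ `Q refl Qa)))))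

    P∪Q⊆U⇔ : ∀ s → (∀ a → P a ⊎ Q a → U a) ⇔ (¬ (s ⊨ᶠ ∃ᶠ x (¬ᶠ U' x ∧ᶠ (P' x ∨ᶠ Q' x))))
    P∪Q⊆U⇔ s = mk⇔
      (λ sup (a , ¬Ua , P⊎Q) → ¬Ua (a , refl , sup a (Sum.map (atom₁ `P refl) (atom₁ `Q refl) P⊎Q)))
      (λ ¬φ a P⊎Q → stable λ ¬Ua → ¬φ (a , (λ Ua → ¬Ua (atom₁ `U refl Ua)) ,
        Sum.map (λ Pa → a , refl , Pa) (λ Qa → a , refl , Qa) P⊎Q))

    regroup : (TwoPoints × UnionPQ) ⇔
      ((Σ[ p ∈ A ] IsSingleton 𝔄 P p) × (Σ[ q ∈ A ] IsSingleton 𝔄 Q q) ×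
       (∀ a → P a → ¬ Q a) × (∀ a → U a → P a ⊎ Q a) × (∀ a → P a ⊎ Q a → U a))
    regroup = mk⇔
      (λ ((p , q , sP , sQ , p≢q) , union) → (p , sP) , (q , sQ) ,
        (λ a Pa Qa → p≢q (trans (sym (proj₂ sP a Pa)) (proj₂ sQ a Qa))) ,
        (λ a → proj₁ (union a)) , (λ a → proj₂ (union a)))
      (λ ((p , sP) , (q , sQ) , disjoint , sub , sup) →
        (p , q , sP , sQ , λ p≡q → disjoint p (proj₁ sP) (subst Q (sym p≡q) (proj₁ sQ))) ,
        (λ a → sub a , sup a))

    U≠2⇔ : ∀ s → (TwoPoints × UnionPQ) ⇔ (¬ (s ⊨ᶠ φ-U≠2))
    U≠2⇔ s = ⇔-trans regroup
      (×-¬⊎ (singleton⇔ s `P) (×-¬⊎ (singleton⇔ s `Q)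
        (×-¬⊎ (disjoint⇔ s) (×-¬⊎ (U⊆P∪Q⇔ s) (P∪Q⊆U⇔ s)))))

    stripes⇔ : ∀ s → StripedBy C ⇔ (¬ (s ⊨ᶠ φ-non-stripes))
    stripes⇔ s = ⇔-trans pointwise (∀-¬Σ λ a → ∀-¬Σ λ b → ×-¬⊎ (H-stripe⇔ a b) (V-stripe⇔ a b))
      where
      H-clause V-clause : A → A → Set
      H-clause a b = H a b → (C a → C b) × (C b → C a)
      V-clause a b = V a b → (C a → ¬ C b) × (¬ C b → C a)
      H-violation V-violation : A → A → Set
      H-violation a b = ((s [ a / x ]) [ b / y ]) ⊨ᶠ (H' x y ∧ᶠ (C' x ↔ᶠ ¬ᶠ C' y))
      V-violation a b = ((s [ a / x ]) [ b / y ]) ⊨ᶠ (V' x y ∧ᶠ (C' x ↔ᶠ C' y))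

      pointwise : StripedBy C ⇔ (∀ a b → H-clause a b × V-clause a b)
      pointwise = mk⇔ (λ (hs , vs) a b → hs a b , vs a b)
                      (λ st → (λ a b → proj₁ (st a b)) , (λ a b → proj₂ (st a b)))

      H-stripe⇔ : ∀ a b → H-clause a b ⇔ (¬ H-violation a b)
      H-stripe⇔ a b = mk⇔ refute establish
        where
        refute : H-clause a b → ¬ H-violation a b
        refute stripe (hab , Cx→¬Cy , ¬Cy→Cx) =
          ¬Ca (atom₁ `C refl (¬Cy→Cx λ Cy → ¬Ca (proj₂ same (atom₁ `C refl Cy))))
          where
          same : (C a → C b) × (C b → C a)
          same = stripe (atom₂ `H refl refl hab)
          ¬Ca : ¬ C a
          ¬Ca Ca = Cx→¬Cy (a , refl , Ca) (b , refl , proj₁ same Ca)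
        establish : ¬ H-violation a b → H-clause a b
        establish ¬φ hab =
          (λ Ca → stable λ ¬Cb → ¬φ (edge , (λ _ Cy → ¬Cb (atom₁ `C refl Cy)) , (λ _ → a , refl , Ca))) ,
          (λ Cb → stable λ ¬Ca → ¬φ (edge , (λ Cx → ⊥-elim (¬Ca (atom₁ `C refl Cx))) ,
                                            (λ ¬Cy → ⊥-elim (¬Cy (b , refl , Cb)))))
          where
          edge : Edge `H (just a) (just b)
          edge = (a , b , refl , refl , hab)

      V-stripe⇔ : ∀ a b → V-clause a b ⇔ (¬ V-violation a b)
      V-stripe⇔ a b = mk⇔ refute establish
        where
        refute : V-clause a b → ¬ V-violation a b
        refute stripe (vab , Cx→Cy , Cy→Cx) = ¬Ca (proj₂ alternate ¬Cb)
          where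
          alternate : (C a → ¬ C b) × (¬ C b → C a)
          alternate = stripe (atom₂ `V refl refl vab)
          ¬Ca : ¬ C a
          ¬Ca Ca = proj₁ alternate Ca (atom₁ `C refl (Cx→Cy (a , refl , Ca)))
          ¬Cb : ¬ C b
          ¬Cb Cb = ¬Ca (atom₁ `C refl (Cy→Cx (b , refl , Cb)))
        establish : ¬ V-violation a b → V-clause a b
        establish ¬φ vab =
          (λ Ca Cb → ¬φ (edge , (λ _ → b , refl , Cb) , (λ _ → a , refl , Ca))) ,
          (λ ¬Cb → stable λ ¬Ca → ¬φ (edge , (λ Cx → ⊥-elim (¬Ca (atom₁ `C refl Cx))) ,
                                             (λ Cy → ⊥-elim (¬Cb (atom₁ `C refl Cy)))))
          where
          edge : Edge `V (just a) (just b)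
          edge = (a , b , refl , refl , vab)

    first-order⇔ : ∀ s → FirstOrderConditions ⇔ (¬ (s ⊨ᶠ φ-first-order))
    first-order⇔ s = ×-¬⊎ (serial⇔ s) (×-¬⊎ (U≠2⇔ s) (stripes⇔ s))

    join-complete : ∀ {f l Fst Lst p q} → (∀ u → U u → u ≡ p ⊎ u ≡ q) →
      Expresses f Fst → Expresses l Lst → JoinWitness Fst Lst → (W : Team) → W ⊨ᵀ φ-join-shape f l
    join-complete {f} {l} U⊆pq ef el w W =
      ∨-cover (fo (¬ᶠ U' x)) (branches f l) (¬_ ∘ InU) InU (λ t _ → Sum.swap (toSum (decide (InU t))))
              (lift λ t m → proj₂ m) (branches-complete ef el w in-U)
      where
      InU : Assignment → Set
      InU t = Σ[ u ∈ A ] (t x ≡ just u × U u)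
      in-U : TwoValues (λ t → duplicate W x t × InU t) x _ _
      in-U t (_ , u , tx , Uu) = Sum.map (trans tx ∘ cong just) (trans tx ∘ cong just) (U⊆pq u Uu)

    failure-witness : ∀ {K Lst a b c b′ c′} → StripedBy K → (∀ {e} → Lst e → ¬ K e) →
      V a b → H b c → H a b′ → V b′ c′ → c ≢ c′ → Lst a → JoinWitness K Lst
    failure-witness {K} {a = a} {b} {c} {b′} {c′} (hs , vs) Lst⇒¬K vab hbc hab′ vb′c′ c≢c′ La =
      join-witness a b c b′ c′ hbc vb′c′ (inj₁ vab) (inj₂ hab′) c≢c′ b≢b′ Kc Kc′ La
      where
      Kb : K b
      Kb = stable λ ¬Kb → Lst⇒¬K La (proj₂ (vs a b vab) ¬Kb)
      Kc : K c
      Kc = proj₁ (hs b c hbc) Kb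
      ¬Kb′ : ¬ K b′
      ¬Kb′ Kb′ = Lst⇒¬K La (proj₂ (hs a b′ hab′) Kb′)
      Kc′ : K c′
      Kc′ = stable λ ¬Kc′ → ¬Kb′ (proj₂ (vs b′ c′ vb′c′) ¬Kc′)
      b≢b′ : b ≢ b′
      b≢b′ refl = ¬Kb′ Kb

    non-join-holds : FirstOrderConditions → ∀ {a b c b′ c′} →
      V a b → H b c → H a b′ → V b′ c′ → c ≢ c′ → 𝔄 ⊨ φ-non-join
    non-join-holds (_ , shape , stripes) {a} vab hbc hab′ vb′c′ c≢c′
      with U-two-points shape | decide (C a)
    ... | _ , _ , _ , _ , _ , U⊆pq | no ¬Ca = ∨-introˡ φ-non-C⁺-join φ-non-C⁻-join
      (join-complete U⊆pq expresses-C expresses-¬C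
        (failure-witness stripes id vab hbc hab′ vb′c′ c≢c′ ¬Ca) emptyTeam)
    ... | _ , _ , _ , _ , _ , U⊆pq | yes Ca = ∨-introʳ φ-non-C⁺-join φ-non-C⁻-join
      (join-complete U⊆pq expresses-¬C expresses-C
        (failure-witness (striped-¬ stripes) (λ Ce ¬Ce → ¬Ce Ce) vab hbc hab′ vb′c′ c≢c′ Ca)
        emptyTeam)

    ∅ : Assignment
    ∅ _ = nothing

    striped⇒¬non-grid : StripedGridlike 𝔄 → ¬ (𝔄 ⊨ φ-non-grid)
    striped⇒¬non-grid ((serV , serH , grid) , twoPoints , union , stripes) holds
      with ∨-elim {s = ∅} {fo φ-first-order} {φ-non-join} (emptyTeam , (λ _ → refl) , holds)
    ... | inj₁ (_ , m , lift first-order) =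
          Equivalence.to (first-order⇔ ∅) ((serV , serH) , (twoPoints , union) , stripes) (first-order _ m)
    ... | inj₂ join = join-refuted grid (twoPoints , union) stripes join

    ¬non-grid⇒striped : ¬ (𝔄 ⊨ φ-non-grid) → StripedGridlike 𝔄
    ¬non-grid⇒striped ¬φ = (proj₁ serial , proj₂ serial , grid) , proj₁ shape , proj₂ shape , stripes
      where
      conditions : FirstOrderConditions
      conditions = stable λ ¬conditions → ¬φ (∨-introˡ (fo φ-first-order) φ-non-join
        (lift λ s _ → stable (¬conditions ∘ Equivalence.from (first-order⇔ s))))
      serial : Serial
      serial = proj₁ conditions
      shape : TwoPoints × UnionPQ
      shape = proj₁ (proj₂ conditions)
      stripes : StripedBy C
      stripes = proj₂ (proj₂ conditions)
      grid : GridEquation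
      grid a b c b′ c′ vab hbc hab′ vb′c′ = stable λ c≢c′ →
        ¬φ (∨-introʳ (fo φ-first-order) φ-non-join (non-join-holds conditions vab hbc hab′ vb′c′ c≢c′))

lemma17 : ExcludedMiddle (lsuc 0ℓ) →
    (𝔄 : Structure) → StripedGridlike 𝔄 ⇔ (¬ (𝔄 ⊨ φ-non-grid))
lemma17 em 𝔄 = mk⇔ striped⇒¬non-grid ¬non-grid⇒striped
  where open Classical 𝔄 em
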